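{- Let $k, k'$ be fields of characteristic $\ne 2$. If $m_{i,1}(k) = m_{i,1}(k')$ for all integers $i \geq 1$, then $u(k) = u(k')$.
   Context: All quadratic forms are regular; $i_W(q)$ is the Witt index of $q$. $u(k)$ is the maximal dimension of an anisotropic quadratic form over $k$ ($\infty$ if there is no maximum). For integers $i,j\ge1$, $m_{i,j}(k)$ is the infimum of $\dim q \ge 1$ over quadratic forms $q$ over $k$ such that $i_W(q) < j$ and $i_W(q \perp \sigma_i) \geq j$ for every $i$-dimensional quadratic form $\sigma_i$ over $k$, with the infimum of the empty set equal to $\infty$. -}

module Defs where

open import Level using (Level; _⊔_) renaming (suc to lsuc)
open import Algebra.Bundles using (CommutativeRing)
open import Data.Nat using (ℕ; zero; suc; _≤_; _<_) renaming (_+_ to _+ℕ_)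
open import Data.Fin using (Fin; splitAt)
import Data.Fin as Fin
open import Data.Sum using (_⊎_; inj₁; inj₂)
open import Data.Product using (Σ; ∃; _×_; _,_)
open import Relation.Nullary using (¬_; Dec)

record Field (c ℓ : Level) : Set (lsuc (c ⊔ ℓ)) where
  field
    commutativeRing : CommutativeRing c ℓ
  open CommutativeRing commutativeRing public
  field
    0≉1 : ¬ (0# ≈ 1#)
    inverse : ∀ x → ¬ (x ≈ 0#) → ∃ λ y → x * y ≈ 1#

CharNot2 : ∀ {c ℓ} → Field c ℓ → Set ℓ
CharNot2 k = ¬ (1# + 1# ≈ 0#)
  where open Field k

ExcludedMiddle : (a : Level) → Set (lsuc a)
ExcludedMiddle a = (P : Set a) → Dec P

data ℕ∞ : Set where
  fin : ℕ → ℕ∞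
  ∞   : ℕ∞

IsInf : ∀ {a} → (ℕ → Set a) → ℕ∞ → Set a
IsInf P (fin n) = P n × (∀ m → P m → n ≤ m)
IsInf P ∞       = ∀ n → ¬ P n

IsMaxOr∞ : ∀ {a} → (ℕ → Set a) → ℕ∞ → Set a
IsMaxOr∞ P (fin n) = P n × (∀ m → P m → m ≤ n)
IsMaxOr∞ P ∞       = ∀ n → ∃ λ m → n ≤ m × P m

module QuadraticForms {c ℓ} (k : Field c ℓ) where
  open Field k

  K = Carrier

  ∑ : ∀ n → (Fin n → K) → K
  ∑ zero    f = 0#
  ∑ (suc n) f = f Fin.zero + ∑ n (λ i → f (Fin.suc i))

  Vector : ℕ → Set c
  Vector n = Fin n → K

  _≈ᵥ_ : ∀ {n} → Vector n → Vector n → Set ℓ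
  x ≈ᵥ y = ∀ i → x i ≈ y i

  0ᵥ : ∀ {n} → Vector n
  0ᵥ _ = 0#

  -- A quadratic form of dimension n on K^n, given by its symmetric
  -- (Gram) matrix B: q(x) = Σ_{i,j} B i j x_i x_j,  b(x,y) = Σ B i j x_i y_j.
  record QForm (n : ℕ) : Set (c ⊔ ℓ) where
    field
      B   : Fin n → Fin n → K
      sym : ∀ i j → B i j ≈ B j i

  open QForm public

  bil : ∀ {n} → QForm n → Vector n → Vector n → K
  bil q x y = ∑ _ λ i → ∑ _ λ j → B q i j * (x i * y j)

  val : ∀ {n} → QForm n → Vector n → K
  val q x = bil q x x

  Regular : ∀ {n} → QForm n → Set (c ⊔ ℓ)
  Regular q = ∀ x → (∀ y → bil q x y ≈ 0#) → x ≈ᵥ 0ᵥ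

  Anisotropic : ∀ {n} → QForm n → Set (c ⊔ ℓ)
  Anisotropic q = ∀ x → val q x ≈ 0# → x ≈ᵥ 0ᵥ

  _⊥_ : ∀ {n m} → QForm n → QForm m → QForm (n +ℕ m)
  _⊥_ {n} {m} q σ = record { B = M ; sym = S }
    where
    M : Fin (n +ℕ m) → Fin (n +ℕ m) → K
    M i j with splitAt n i | splitAt n j
    ... | inj₁ i' | inj₁ j' = B q i' j'
    ... | inj₂ i' | inj₂ j' = B σ i' j'
    ... | inj₁ _  | inj₂ _  = 0#
    ... | inj₂ _  | inj₁ _  = 0#
    S : ∀ i j → M i j ≈ M j i
    S i j with splitAt n i | splitAt n j
    ... | inj₁ i' | inj₁ j' = QForm.sym q i' j'
    ... | inj₂ i' | inj₂ j' = QForm.sym σ i' j'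
    ... | inj₁ _  | inj₂ _  = refl
    ... | inj₂ _  | inj₁ _  = refl

  LinIndep : ∀ {n j} → (Fin j → Vector n) → Set (c ⊔ ℓ)
  LinIndep {n} {j} v =
    ∀ (a : Fin j → K) → (∀ t → ∑ j (λ s → a s * v s t) ≈ 0#) → ∀ s → a s ≈ 0#

  WittIndex≥ : ∀ {n} → QForm n → ℕ → Set (c ⊔ ℓ)
  WittIndex≥ {n} q j =
    Σ (Fin j → Vector n) λ v → LinIndep v × (∀ s t → bil q (v s) (v t) ≈ 0#)

  MCandidate : ℕ → ℕ → ℕ → Set (c ⊔ ℓ)
  MCandidate i j n =
    1 ≤ n × Σ (QForm n) λ q → Regular q × ¬ WittIndex≥ q j ×
      (∀ (σ : QForm i) → Regular σ → WittIndex≥ (q ⊥ σ) j)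

  AnisoDim : ℕ → Set (c ⊔ ℓ)
  AnisoDim n = Σ (QForm n) λ q → Regular q × Anisotropic q

m[_,_]_≡_ : ∀ {c ℓ} → ℕ → ℕ → Field c ℓ → ℕ∞ → Set (c ⊔ ℓ)
m[ i , j ] k ≡ v = IsInf (QuadraticForms.MCandidate k i j) v

u_≡_ : ∀ {c ℓ} → Field c ℓ → ℕ∞ → Set (c ⊔ ℓ)
u k ≡ v = IsMaxOr∞ (QuadraticForms.AnisoDim k) v

{-# OPTIONS --safe #-}
module Submission where

-- m_{i,1}(k) = 1 exactly when every anisotropic form over k has dimension at most i.
-- If so, ⟨1⟩ ⊥ σ is isotropic for every i-dimensional σ, so ⟨1⟩ witnesses m_{i,1}(k) = 1.
-- Conversely, let q = ⟨a⟩ be anisotropic and φ anisotropic of dimension > i. Splitting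
-- off φ(e₀) = b by Gram–Schmidt and rescaling by a/b turns the restriction of φ to an
-- (i+1)-dimensional subspace into q ⊥ σ, which is anisotropic, so q is not a witness.
-- Hence the hypothesis says u(k) ≤ i ⇔ u(k') ≤ i for all i ≥ 1, and since u ≥ 1 this
-- forces u(k) = u(k').

open import Defs
open import Level using (_⊔_; Lift; lift; lower)
open import Data.Nat using (ℕ; zero; suc; _≤_; _<_; z≤n; s≤s)
open import Data.Nat.Properties using (≤-refl; ≤-trans; ≤-antisym; <⇒≤; <⇒≱; ≮⇒≥; n≤1+n; 1+n≰n)
open import Data.Fin using (Fin; zero; suc; toℕ; inject≤)
open import Data.Fin.Properties using (toℕ-inject≤)
open import Data.Vec.Functional using (_∷_)
open import Data.Product using (Σ; ∃; ∃₂; _×_; _,_; proj₁; proj₂)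
open import Function.Base using (_∘_)
open import Function.Bundles using (_⇔_; mk⇔; Equivalence)
import Function.Properties.Equivalence as ⇔
open import Relation.Nullary using (¬_; contradiction)
open import Relation.Nullary.Decidable using (map′; decidable-stable)
open import Relation.Binary.PropositionalEquality as ≡ using (_≡_; subst)

UpperBound : ∀ {a} → (ℕ → Set a) → ℕ → Set a
UpperBound P i = ∀ n → P n → n ≤ i

lowerExcludedMiddle : ∀ {a} b → ExcludedMiddle (a ⊔ b) → ExcludedMiddle a
lowerExcludedMiddle b em P = map′ lower lift (em (Lift b P))

¬UpperBound⇒exceeds : ∀ {a} {P : ℕ → Set a} → ExcludedMiddle a →
                      ∀ {i} → ¬ UpperBound P i → ∃ λ n → i < n × P n
¬UpperBound⇒exceeds em ¬bound = decidable-stable (em _) λ ¬exceeds →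
  ¬bound λ n Pn → ≮⇒≥ λ i<n → ¬exceeds (n , i<n , Pn)

module _ {a b} {P : ℕ → Set a} {Q : ℕ → Set b} (em : ExcludedMiddle b) (P1 : P 1) (Q1 : Q 1)
         (bounds : ∀ i → 1 ≤ i → UpperBound P i ⇔ UpperBound Q i) where

  private
    exceeds : ∀ {i m} → P m → suc i < m → ∃ λ n → suc i < n × Q n
    exceeds Pm i<m = ¬UpperBound⇒exceeds em λ boundQ →
      <⇒≱ i<m (Equivalence.from (bounds _ (s≤s z≤n)) boundQ _ Pm)

  IsMaxOr∞-transfer : ∀ v → IsMaxOr∞ P v → IsMaxOr∞ Q v
  IsMaxOr∞-transfer (fin zero) (_ , boundP) = contradiction (boundP 1 P1) λ ()
  IsMaxOr∞-transfer (fin 1) (_ , boundP) = Q1 , Equivalence.to (bounds 1 ≤-refl) boundP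
  IsMaxOr∞-transfer (fin (suc (suc n))) (Pn , boundP) =
    let boundQ         = Equivalence.to (bounds (suc (suc n)) (s≤s z≤n)) boundP
        (m , n<m , Qm) = exceeds Pn ≤-refl
    in subst Q (≤-antisym (boundQ m Qm) n<m) Qm , boundQ
  IsMaxOr∞-transfer ∞ unboundedP n =
    let (m , n<m , Pm)    = unboundedP (suc (suc n))
        (m' , n<m' , Qm') = exceeds Pm n<m
    in m' , ≤-trans (n≤1+n n) (<⇒≤ n<m') , Qm'

module Forms {c ℓ} (k : Field c ℓ) where
  open Field k hiding (zero)
  open QuadraticForms k hiding (sym)
  open import Algebra.Properties.Semiring.Sum semiring
    using (sum; sum-cong-≋; sum-replicate-zero; *-distribˡ-sum; *-distribʳ-sum)
    renaming (∑-comm to sum-comm)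
  open import Algebra.Properties.Ring ring using (-‿distribʳ-*)
  open import Algebra.Properties.CommutativeSemigroup *-commutativeSemigroup
    using (x∙yz≈y∙xz; xy∙z≈y∙xz)
  open import Algebra.Solver.Ring.NaturalCoefficients.Default commutativeSemiring
    using (solve; _:*_; _:=_)
  open import Relation.Binary.Reasoning.Setoid setoid

  ∑≡sum : ∀ n (f : Vector n) → ∑ n f ≡ sum f
  ∑≡sum zero    f = ≡.refl
  ∑≡sum (suc n) f = ≡.cong (f zero +_) (∑≡sum n (f ∘ suc))

  ∑-cong : ∀ n {f g : Vector n} → f ≈ᵥ g → ∑ n f ≈ ∑ n g
  ∑-cong n {f} {g} f≈g = begin
    ∑ n f  ≡⟨ ∑≡sum n f ⟩
    sum f  ≈⟨ sum-cong-≋ f≈g ⟩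
    sum g  ≡⟨ ∑≡sum n g ⟨
    ∑ n g  ∎

  ∑-zero : ∀ n {f : Vector n} → f ≈ᵥ 0ᵥ → ∑ n f ≈ 0#
  ∑-zero n {f} f≈0 = begin
    ∑ n f         ≈⟨ ∑-cong n f≈0 ⟩
    ∑ n 0ᵥ        ≡⟨ ∑≡sum n 0ᵥ ⟩
    sum {n} 0ᵥ    ≈⟨ sum-replicate-zero n ⟩
    0#            ∎

  *-distribˡ-∑ : ∀ n x (f : Vector n) → x * ∑ n f ≈ ∑ n (λ i → x * f i)
  *-distribˡ-∑ n x f = begin
    x * ∑ n f            ≡⟨ ≡.cong (x *_) (∑≡sum n f) ⟩
    x * sum f            ≈⟨ *-distribˡ-sum x f ⟩
    sum (λ i → x * f i)  ≡⟨ ∑≡sum n _ ⟨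
    ∑ n (λ i → x * f i)  ∎

  *-distribʳ-∑ : ∀ n x (f : Vector n) → ∑ n f * x ≈ ∑ n (λ i → f i * x)
  *-distribʳ-∑ n x f = begin
    ∑ n f * x            ≡⟨ ≡.cong (_* x) (∑≡sum n f) ⟩
    sum f * x            ≈⟨ *-distribʳ-sum x f ⟩
    sum (λ i → f i * x)  ≡⟨ ∑≡sum n _ ⟨
    ∑ n (λ i → f i * x)  ∎

  ∑-comm : ∀ m n (f : Fin m → Fin n → K) →
           ∑ m (λ i → ∑ n (f i)) ≈ ∑ n (λ j → ∑ m (λ i → f i j))
  ∑-comm m n f = begin
    ∑ m (λ i → ∑ n (f i))          ≈⟨ ∑-cong m (λ i → reflexive (∑≡sum n (f i))) ⟩
    ∑ m (λ i → sum (f i))          ≡⟨ ∑≡sum m _ ⟩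
    sum (λ i → sum (f i))          ≈⟨ sum-comm f ⟩
    sum (λ j → sum (λ i → f i j))  ≡⟨ ∑≡sum n _ ⟨
    ∑ n (λ j → sum (λ i → f i j))  ≈⟨ ∑-cong n (λ j → reflexive (∑≡sum m _)) ⟨
    ∑ n (λ j → ∑ m (λ i → f i j))  ∎

  ∑²-comm : ∀ m n (f : Fin m → Fin m → Fin n → Fin n → K) →
            ∑ m (λ t → ∑ m (λ u → ∑ n (λ r → ∑ n (f t u r)))) ≈
            ∑ n (λ r → ∑ n (λ s → ∑ m (λ t → ∑ m (λ u → f t u r s))))
  ∑²-comm m n f =
    trans (∑-cong m (λ t → ∑-comm m n (λ u r → ∑ n (f t u r))))
    (trans (∑-comm m n (λ t r → ∑ m (λ u → ∑ n (f t u r))))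
    (trans (∑-cong n (λ r → ∑-cong m (λ t → ∑-comm m n (λ u → f t u r))))
           (∑-cong n (λ r → ∑-comm m n (λ t s → ∑ m (λ u → f t u r s))))))

  ∑*∑ : ∀ m n (f : Vector m) (g : Vector n) → ∑ m f * ∑ n g ≈ ∑ m (λ r → ∑ n (λ s → f r * g s))
  ∑*∑ m n f g = trans (*-distribʳ-∑ m _ f) (∑-cong m λ r → *-distribˡ-∑ n (f r) g)

  -- Indices are compared as naturals, so that entries of Fin i and Fin m can be matched.
  δ : ℕ → ℕ → K
  δ zero    zero    = 1#
  δ zero    (suc _) = 0#
  δ (suc _) zero    = 0#
  δ (suc m) (suc n) = δ m n

  δ-sym : ∀ m n → δ m n ≡ δ n m
  δ-sym zero    zero    = ≡.refl
  δ-sym zero    (suc n) = ≡.refl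
  δ-sym (suc m) zero    = ≡.refl
  δ-sym (suc m) (suc n) = δ-sym m n

  ∑-δ : ∀ {n} (f : Vector n) (r : Fin n) {j} → toℕ r ≡ j → ∑ n (λ t → f t * δ j (toℕ t)) ≈ f r
  ∑-δ {suc n} f zero ≡.refl = begin
    f zero * 1# + ∑ n (λ t → f (suc t) * 0#)  ≈⟨ +-cong (*-identityʳ _) (∑-zero n λ t → zeroʳ _) ⟩
    f zero + 0#                               ≈⟨ +-identityʳ _ ⟩
    f zero                                    ∎
  ∑-δ {suc n} f (suc r) ≡.refl = begin
    f zero * 0# + ∑ n (λ t → f (suc t) * δ (toℕ r) (toℕ t))  ≈⟨ +-cong (zeroʳ _) (∑-δ (f ∘ suc) r ≡.refl) ⟩
    0# + f (suc r)                                           ≈⟨ +-identityˡ _ ⟩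
    f (suc r)                                                ∎

  e₀ : ∀ {n} → Vector (suc n)
  e₀ t = δ 0 (toℕ t)

  1≉0 : ¬ 1# ≈ 0#
  1≉0 = 0≉1 ∘ sym

  x*y≈0⇒y≈0 : ∀ {x y} → ¬ x ≈ 0# → x * y ≈ 0# → y ≈ 0#
  x*y≈0⇒y≈0 {x} {y} x≉0 xy≈0 with inverse x x≉0
  ... | x⁻¹ , xx⁻¹≈1 = begin
    y              ≈⟨ *-identityˡ y ⟨
    1# * y         ≈⟨ *-congʳ xx⁻¹≈1 ⟨
    (x * x⁻¹) * y  ≈⟨ xy∙z≈y∙xz x x⁻¹ y ⟩
    x⁻¹ * (x * y)  ≈⟨ *-congˡ xy≈0 ⟩
    x⁻¹ * 0#       ≈⟨ zeroʳ x⁻¹ ⟩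
    0#             ∎

  bil-sym : ∀ {n} (ψ : QForm n) x y → bil ψ x y ≈ bil ψ y x
  bil-sym {n} ψ x y = trans (∑-comm n n _)
    (∑-cong n λ j → ∑-cong n λ i → *-cong (QForm.sym ψ i j) (*-comm (x i) (y j)))

  bil-congᴳ : ∀ {n} (ψ ψ' : QForm n) → (∀ r s → B ψ r s ≈ B ψ' r s) → ∀ x y → bil ψ x y ≈ bil ψ' x y
  bil-congᴳ _ _ ψ≈ψ' x y = ∑-cong _ λ r → ∑-cong _ λ s → *-congʳ (ψ≈ψ' r s)

  bil-e₀ˡ : ∀ {n} (φ : QForm (suc n)) y → bil φ e₀ y ≈ ∑ (suc n) (λ u → B φ zero u * y u)
  bil-e₀ˡ {n} φ y = begin
    ∑ (suc n) (λ u → B φ zero u * (1# * y u)) + ∑ n (λ t → ∑ (suc n) (λ u → B φ (suc t) u * (0# * y u)))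
      ≈⟨ +-cong (∑-cong (suc n) λ u → *-congˡ {B φ zero u} (*-identityˡ (y u)))
                (∑-zero n λ t → ∑-zero (suc n) λ u → trans (*-congˡ (zeroˡ (y u))) (zeroʳ (B φ (suc t) u))) ⟩
    ∑ (suc n) (λ u → B φ zero u * y u) + 0#
      ≈⟨ +-identityʳ _ ⟩
    ∑ (suc n) (λ u → B φ zero u * y u) ∎

  val-dim1 : (q : QForm 1) (x : Vector 1) → val q x ≈ B q zero zero * (x zero * x zero)
  val-dim1 q x = trans (+-identityʳ _) (+-identityʳ _)

  scale : ∀ {n} → K → QForm n → QForm n
  scale d ψ = record { B = λ r s → d * B ψ r s ; sym = λ r s → *-congˡ (QForm.sym ψ r s) }

  bil-scale : ∀ {n} d (ψ : QForm n) x y → bil (scale d ψ) x y ≈ d * bil ψ x y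
  bil-scale {n} d ψ x y = begin
    ∑ n (λ r → ∑ n (λ s → d * B ψ r s * (x r * y s)))    ≈⟨ ∑-cong n (λ r → ∑-cong n λ s → *-assoc _ _ _) ⟩
    ∑ n (λ r → ∑ n (λ s → d * (B ψ r s * (x r * y s))))  ≈⟨ ∑-cong n (λ r → *-distribˡ-∑ n d _) ⟨
    ∑ n (λ r → d * ∑ n (λ s → B ψ r s * (x r * y s)))    ≈⟨ *-distribˡ-∑ n d _ ⟨
    d * bil ψ x y                                        ∎

  linComb : ∀ {a n} → (Fin a → Vector n) → Vector a → Vector n
  linComb {a} M x t = ∑ a (λ r → x r * M r t)

  pullback : ∀ {a n} → QForm n → (Fin a → Vector n) → QForm a
  pullback φ M = record { B = λ r s → bil φ (M r) (M s) ; sym = λ r s → bil-sym φ (M r) (M s) }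

  bil-pullback : ∀ {a n} (φ : QForm n) (M : Fin a → Vector n) x y →
                 bil (pullback φ M) x y ≈ bil φ (linComb M x) (linComb M y)
  bil-pullback {a} {n} φ M x y = begin
    ∑ a (λ r → ∑ a (λ s → bil φ (M r) (M s) * (x r * y s)))    ≈⟨ ∑-cong a (λ r → ∑-cong a (expandˡ r)) ⟩
    ∑ a (λ r → ∑ a (λ s → ∑ n (λ t → ∑ n (λ u → G t u r s))))  ≈⟨ ∑²-comm n a G ⟨
    ∑ n (λ t → ∑ n (λ u → ∑ a (λ r → ∑ a (G t u r))))          ≈⟨ ∑-cong n (λ t → ∑-cong n (expandʳ t)) ⟨
    bil φ (linComb M x) (linComb M y)                          ∎
    where
    G : Fin n → Fin n → Fin a → Fin a → K
    G t u r s = B φ t u * ((x r * M r t) * (y s * M s u))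

    expandˡ : ∀ r s → bil φ (M r) (M s) * (x r * y s) ≈ ∑ n (λ t → ∑ n (λ u → G t u r s))
    expandˡ r s = trans (*-distribʳ-∑ n _ _) (∑-cong n λ t → trans (*-distribʳ-∑ n _ _) (∑-cong n λ u →
      solve 5 (λ β m m' ξ η → (β :* (m :* m')) :* (ξ :* η) := β :* ((ξ :* m) :* (η :* m')))
            refl (B φ t u) (M r t) (M s u) (x r) (y s)))

    expandʳ : ∀ t u → B φ t u * (linComb M x t * linComb M y u) ≈ ∑ a (λ r → ∑ a (G t u r))
    expandʳ t u = trans (*-congˡ (∑*∑ a a _ _))
                        (trans (*-distribˡ-∑ a _ _) (∑-cong a λ r → *-distribˡ-∑ a _ _))

  anisotropic⇒regular : ∀ {n} (ψ : QForm n) → Anisotropic ψ → Regular ψ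
  anisotropic⇒regular _ ψ-aniso x x⊥ = ψ-aniso x (x⊥ x)

  anisotropic-congᴳ : ∀ {n} (ψ ψ' : QForm n) → (∀ r s → B ψ r s ≈ B ψ' r s) →
                      Anisotropic ψ → Anisotropic ψ'
  anisotropic-congᴳ ψ ψ' ψ≈ψ' ψ-aniso x val≈0 = ψ-aniso x (trans (bil-congᴳ ψ ψ' ψ≈ψ' x x) val≈0)

  scale-anisotropic : ∀ {n} d (ψ : QForm n) → ¬ d ≈ 0# → Anisotropic ψ → Anisotropic (scale d ψ)
  scale-anisotropic d ψ d≉0 ψ-aniso x val≈0 =
    ψ-aniso x (x*y≈0⇒y≈0 d≉0 (trans (sym (bil-scale d ψ x x)) val≈0))

  pullback-anisotropic : ∀ {a n} (φ : QForm n) (M : Fin a → Vector n) →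
                         Anisotropic φ → LinIndep M → Anisotropic (pullback φ M)
  pullback-anisotropic φ M φ-aniso M-indep x val≈0 =
    M-indep x (φ-aniso (linComb M x) (trans (sym (bil-pullback φ M x x)) val≈0))

  LinIndep-tail : ∀ {n j} (v : Fin (suc j) → Vector n) → LinIndep v → LinIndep (v ∘ suc)
  LinIndep-tail _ v-indep a a·v≈0 s =
    v-indep (0# ∷ a) (λ t → trans (+-cong (zeroˡ _) (a·v≈0 t)) (+-identityˡ 0#)) (suc s)

  Isotropic : ∀ {n} → QForm n → Set (c ⊔ ℓ)
  Isotropic {n} ψ = ∃₂ λ (x : Vector n) t → val ψ x ≈ 0# × ¬ x t ≈ 0#

  isotropic⇒WittIndex≥1 : ∀ {n} (ψ : QForm n) → Isotropic ψ → WittIndex≥ ψ 1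
  isotropic⇒WittIndex≥1 _ (x , t , val≈0 , xt≉0) = (λ _ → x) , independent , λ _ _ → val≈0
    where
    independent : LinIndep {j = 1} (λ _ → x)
    independent a a·x≈0 zero =
      x*y≈0⇒y≈0 xt≉0 (trans (*-comm (x t) (a zero)) (trans (sym (+-identityʳ _)) (a·x≈0 t)))

  anisotropic⇒¬WittIndex≥1 : ∀ {n} (ψ : QForm n) → Anisotropic ψ → ¬ WittIndex≥ ψ 1
  anisotropic⇒¬WittIndex≥1 _ ψ-aniso (v , v-indep , v-isotropic) = 1≉0 (v-indep (λ _ → 1#) 1·v₀≈0 zero)
    where
    1·v₀≈0 : ∀ t → 1# * v zero t + 0# ≈ 0#
    1·v₀≈0 t = trans (+-identityʳ _) (trans (*-identityˡ _) (ψ-aniso (v zero) (v-isotropic zero zero) t))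

  ¬WittIndex≥1⇒B≉0 : (q : QForm 1) → ¬ WittIndex≥ q 1 → ¬ B q zero zero ≈ 0#
  ¬WittIndex≥1⇒B≉0 q ¬witt B≈0 = ¬witt (isotropic⇒WittIndex≥1 q ((λ _ → 1#) , zero , val≈0 , 1≉0))
    where
    val≈0 : val q (λ _ → 1#) ≈ 0#
    val≈0 = trans (val-dim1 q (λ _ → 1#)) (trans (*-congʳ B≈0) (zeroˡ (1# * 1#)))

  module ⊥-Extension {i m} (i≤m : i ≤ m) (φ : QForm (suc m)) (φ-aniso : Anisotropic φ)
                      (q : QForm 1) (a≉0 : ¬ B q zero zero ≈ 0#) where
    a b : K
    a = B q zero zero
    b = B φ zero zero

    bil-e₀e₀ : bil φ e₀ e₀ ≈ b
    bil-e₀e₀ = trans (bil-e₀ˡ φ e₀) (∑-δ (B φ zero) zero ≡.refl)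

    b≉0 : ¬ b ≈ 0#
    b≉0 b≈0 = 1≉0 (φ-aniso e₀ (trans bil-e₀e₀ b≈0) zero)

    b⁻¹ : K
    b⁻¹ = proj₁ (inverse b b≉0)

    b*[x*b⁻¹]≈x : ∀ x → b * (x * b⁻¹) ≈ x
    b*[x*b⁻¹]≈x x = begin
      b * (x * b⁻¹)  ≈⟨ x∙yz≈y∙xz b x b⁻¹ ⟩
      x * (b * b⁻¹)  ≈⟨ *-congˡ (proj₂ (inverse b b≉0)) ⟩
      x * 1#         ≈⟨ *-identityʳ x ⟩
      x              ∎

    d : K
    d = a * b⁻¹

    d*b≈a : d * b ≈ a
    d*b≈a = trans (*-comm d b) (b*[x*b⁻¹]≈x a)

    d≉0 : ¬ d ≈ 0#
    d≉0 d≈0 = a≉0 (trans (sym d*b≈a) (trans (*-congʳ d≈0) (zeroˡ b)))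

    -- Gram–Schmidt against e₀: the rows e₀ and e_{j+1} − (B₀,ⱼ₊₁ / b)·e₀ for j < i.
    M : Fin (suc i) → Vector (suc m)
    M zero            = e₀
    M (suc j) zero    = - (B φ zero (suc (inject≤ j i≤m)) * b⁻¹)
    M (suc j) (suc t) = δ (toℕ j) (toℕ t)

    e₀⊥M-suc : ∀ j → bil φ e₀ (M (suc j)) ≈ 0#
    e₀⊥M-suc j = begin
      bil φ e₀ (M (suc j))
        ≈⟨ bil-e₀ˡ φ (M (suc j)) ⟩
      b * - (X * b⁻¹) + ∑ m (λ u → B φ zero (suc u) * δ (toℕ j) (toℕ u))
        ≈⟨ +-cong (sym (-‿distribʳ-* b _)) (∑-δ (B φ zero ∘ suc) (inject≤ j i≤m) (toℕ-inject≤ j i≤m)) ⟩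
      - (b * (X * b⁻¹)) + X
        ≈⟨ +-congʳ (-‿cong (b*[x*b⁻¹]≈x X)) ⟩
      - X + X
        ≈⟨ -‿inverseˡ X ⟩
      0# ∎
      where X = B φ zero (suc (inject≤ j i≤m))

    M-independent : LinIndep M
    M-independent x M·x≈0 = x≈0
      where
      tail≈0 : ∀ j → x (suc j) ≈ 0#
      tail≈0 j = begin
        x (suc j)
          ≈⟨ ∑-δ (x ∘ suc) j (≡.sym (toℕ-inject≤ j i≤m)) ⟨
        ∑ i (λ r → x (suc r) * δ J (toℕ r))
          ≈⟨ ∑-cong i (λ r → *-congˡ (reflexive (δ-sym J (toℕ r)))) ⟩
        ∑ i (λ r → x (suc r) * δ (toℕ r) J)
          ≈⟨ trans (+-cong (zeroʳ (x zero)) refl) (+-identityˡ _) ⟨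
        linComb M x (suc (inject≤ j i≤m))
          ≈⟨ M·x≈0 (suc (inject≤ j i≤m)) ⟩
        0# ∎
        where J = toℕ (inject≤ j i≤m)

      x≈0 : x ≈ᵥ 0ᵥ
      x≈0 zero = begin
        x zero               ≈⟨ *-identityʳ _ ⟨
        x zero * 1#          ≈⟨ +-identityʳ _ ⟨
        x zero * 1# + 0#     ≈⟨ +-congˡ (∑-zero i λ r → trans (*-congʳ (tail≈0 r)) (zeroˡ _)) ⟨
        linComb M x zero     ≈⟨ M·x≈0 zero ⟩
        0#                   ∎
      x≈0 (suc j) = tail≈0 j

    σ : QForm i
    σ = scale d (pullback φ (M ∘ suc))

    σ-anisotropic : Anisotropic σ
    σ-anisotropic = scale-anisotropic d (pullback φ (M ∘ suc)) d≉0 (pullback-anisotropic φ (M ∘ suc) φ-aniso (LinIndep-tail M M-independent))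

    q⊥σ-gram : ∀ r s → B (scale d (pullback φ M)) r s ≈ B (q ⊥ σ) r s
    q⊥σ-gram zero    zero    = trans (*-congˡ bil-e₀e₀) d*b≈a
    q⊥σ-gram zero    (suc s) = trans (*-congˡ (e₀⊥M-suc s)) (zeroʳ d)
    q⊥σ-gram (suc r) zero    = trans (*-congˡ (trans (bil-sym φ (M (suc r)) e₀) (e₀⊥M-suc r))) (zeroʳ d)
    q⊥σ-gram (suc r) (suc s) = refl

    q⊥σ-anisotropic : Anisotropic (q ⊥ σ)
    q⊥σ-anisotropic =
      anisotropic-congᴳ (scale d (pullback φ M)) (q ⊥ σ) q⊥σ-gram
        (scale-anisotropic d (pullback φ M) d≉0 (pullback-anisotropic φ M φ-aniso M-independent))

  anisotropic-⊥-extension : ∀ {i n} → i < n → (φ : QForm n) → Anisotropic φ →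
                            (q : QForm 1) → ¬ B q zero zero ≈ 0# →
                            Σ (QForm i) λ σ → Anisotropic σ × Anisotropic (q ⊥ σ)
  anisotropic-⊥-extension (s≤s i≤m) φ φ-aniso q a≉0 = σ , σ-anisotropic , q⊥σ-anisotropic
    where open ⊥-Extension i≤m φ φ-aniso q a≉0

  candidate⇒bounded : ∀ {i} → MCandidate i 1 1 → UpperBound AnisoDim i
  candidate⇒bounded (_ , q , _ , ¬witt , q⊥σ-witt) n (φ , _ , φ-aniso) = ≮⇒≥ λ i<n →
    let (σ , σ-aniso , q⊥σ-aniso) = anisotropic-⊥-extension i<n φ φ-aniso q (¬WittIndex≥1⇒B≉0 q ¬witt)
    in anisotropic⇒¬WittIndex≥1 (q ⊥ σ) q⊥σ-aniso (q⊥σ-witt σ (anisotropic⇒regular σ σ-aniso))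

module Classical {c ℓ} (k : Field c ℓ) (em : ExcludedMiddle (c ⊔ ℓ)) where
  open Field k hiding (zero)
  open QuadraticForms k hiding (sym)
  open Forms k

  em-ℓ : ExcludedMiddle ℓ
  em-ℓ = lowerExcludedMiddle c em

  x*x≈0⇒x≈0 : ∀ {x} → x * x ≈ 0# → x ≈ 0#
  x*x≈0⇒x≈0 x²≈0 = decidable-stable (em-ℓ _) λ x≉0 → x≉0 (x*y≈0⇒y≈0 x≉0 x²≈0)

  ¬anisotropic⇒isotropic : ∀ {n} (ψ : QForm n) → ¬ Anisotropic ψ → Isotropic ψ
  ¬anisotropic⇒isotropic _ ¬aniso = decidable-stable (em _) λ ¬iso →
    ¬aniso λ x val≈0 t → decidable-stable (em-ℓ _) λ xt≉0 → ¬iso (x , t , val≈0 , xt≉0)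

  ⟨1⟩ : QForm 1
  ⟨1⟩ = record { B = λ _ _ → 1# ; sym = λ _ _ → refl }

  ⟨1⟩-anisotropic : Anisotropic ⟨1⟩
  ⟨1⟩-anisotropic x val≈0 zero =
    x*x≈0⇒x≈0 (trans (sym (*-identityˡ _)) (trans (sym (val-dim1 ⟨1⟩ x)) val≈0))

  anisoDim1 : AnisoDim 1
  anisoDim1 = ⟨1⟩ , anisotropic⇒regular ⟨1⟩ ⟨1⟩-anisotropic , ⟨1⟩-anisotropic

  bounded⇒candidate : ∀ {i} → UpperBound AnisoDim i → MCandidate i 1 1
  bounded⇒candidate {i} bound =
    s≤s z≤n , ⟨1⟩ , anisotropic⇒regular ⟨1⟩ ⟨1⟩-anisotropic , anisotropic⇒¬WittIndex≥1 ⟨1⟩ ⟨1⟩-anisotropic ,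
    λ σ _ → isotropic⇒WittIndex≥1 (⟨1⟩ ⊥ σ) (¬anisotropic⇒isotropic (⟨1⟩ ⊥ σ) λ aniso →
      1+n≰n (bound (suc i) (⟨1⟩ ⊥ σ , anisotropic⇒regular (⟨1⟩ ⊥ σ) aniso , aniso)))

  m[i,1]≡1⇔bounded : ∀ i → (m[ i , 1 ] k ≡ fin 1) ⇔ UpperBound AnisoDim i
  m[i,1]≡1⇔bounded i = mk⇔ (candidate⇒bounded ∘ proj₁) (λ bound → bounded⇒candidate bound , λ _ → proj₁)

theorem3p16 : ∀ {c ℓ c' ℓ'} (k : Field c ℓ) (k' : Field c' ℓ') →
    ExcludedMiddle (c ⊔ ℓ) → ExcludedMiddle (c' ⊔ ℓ') →
    CharNot2 k → CharNot2 k' →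
    (∀ (i : ℕ) → 1 ≤ i → ∀ v → (m[ i , 1 ] k ≡ v) ⇔ (m[ i , 1 ] k' ≡ v)) →
    ∀ v → (u k ≡ v) ⇔ (u k' ≡ v)
theorem3p16 k k' em em' _ _ m≡m' v =
  mk⇔ (IsMaxOr∞-transfer em' (anisoDim1 k em) (anisoDim1 k' em') bounds⇔ v)
      (IsMaxOr∞-transfer em (anisoDim1 k' em') (anisoDim1 k em) (λ i 1≤i → ⇔.sym (bounds⇔ i 1≤i)) v)
  where
  open Classical using (anisoDim1; m[i,1]≡1⇔bounded)

  bounds⇔ : ∀ i → 1 ≤ i → UpperBound (QuadraticForms.AnisoDim k) i ⇔ UpperBound (QuadraticForms.AnisoDim k') i
  bounds⇔ i 1≤i = ⇔.trans (⇔.sym (m[i,1]≡1⇔bounded k em i))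
                          (⇔.trans (m≡m' i 1≤i (fin 1)) (m[i,1]≡1⇔bounded k' em' i))
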